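{- Let $a$ be a positive integer and let $L_{a,a}=\{C_{i,1}:1\le i\le a+1\}\cup\{C_{1,j}:1<j\le a+1\}$ (an $L$-shaped polyomino of size $2a+1$). Then on the $(2a+1)\times(2a+1)$ board, $\mathrm{cp}_{\mathrm{fixed}}(L_{a,a})=1$.
   Context: A cell $C_{i,j}$ ($i,j$ integers) is the closed unit square in column $i$ and row $j$ of the integer grid (column index increases to the right, row index increases downward). A polyomino is a finite set of cells; its size is its number of cells. For a polyomino $\mathcal P$ of size $n$, the board is $\mathbb B=\{C_{i,j}:1\le i,j\le n\}$. A shift of $\mathcal P$ by an integer pair $(c,d)$ is $\{C_{x+c,y+d}:C_{x,y}\in\mathcal P\}$; two polyominoes are fixed equivalent if one is a shift of the other. A set of polyominoes is a valid arrangement if all lie in $\mathbb B$ and they are pairwise disjoint. A fixed packing of $\mathcal P$ is a valid arrangement of polyominoes fixed equivalent to $\mathcal P$ such that adding any further polyomino fixed equivalent to $\mathcal P$ yields an invalid arrangement. The clumsy fixed packing number $\mathrm{cp}_{\mathrm{fixed}}(\mathcal P)$ is the minimum number of polyominoes in a fixed packing of $\mathcal P$ on the $n\times n$ board, $n=|\mathcal P|$. -}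

module Defs where

open import Data.Nat using (ℕ; suc; _≤_)
open import Data.Integer using (ℤ; +_) renaming (_+_ to _+ℤ_; _≤_ to _≤ℤ_)
open import Data.Product using (_×_; _,_; ∃; ∃-syntax; Σ-syntax)
open import Data.List using (List; []; _∷_; map; _++_; length; upTo; lookup)
open import Data.List.Membership.Propositional using (_∈_)
open import Data.List.Relation.Unary.All using (All)
open import Data.Fin using (Fin)
open import Relation.Binary.PropositionalEquality using (_≡_; _≢_)
open import Relation.Nullary using (¬_)
open import Data.Empty using (⊥)
open import Function.Bundles using (_⇔_)

-- A cell C_{i,j} is identified with its pair of integer indices (column i, row j).
Cell : Set
Cell = ℤ × ℤ

-- A polyomino is a finite set of cells, represented by a list of cells
-- (set semantics via membership; the concrete polyominoes used are duplicate-free lists).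
Polyomino : Set
Polyomino = List Cell

size : Polyomino → ℕ
size P = length P

shift : Polyomino → ℤ → ℤ → Polyomino
shift P c d = map (λ { (x , y) → (x +ℤ c , y +ℤ d) }) P

SameCells : Polyomino → Polyomino → Set
SameCells Q R = ∀ (x : Cell) → (x ∈ Q) ⇔ (x ∈ R)

FixedEquiv : Polyomino → Polyomino → Set
FixedEquiv Q P = ∃[ c ] ∃[ d ] SameCells Q (shift P c d)

InBoard : ℕ → Cell → Set
InBoard n (i , j) = (+ 1 ≤ℤ i) × (i ≤ℤ + n) × (+ 1 ≤ℤ j) × (j ≤ℤ + n)

Within : ℕ → Polyomino → Set
Within n Q = ∀ (x : Cell) → x ∈ Q → InBoard n x

Disjoint : Polyomino → Polyomino → Set
Disjoint Q R = ∀ (x : Cell) → x ∈ Q → x ∈ R → ⊥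

ValidArrangement : ℕ → List Polyomino → Set
ValidArrangement n A =
  All (Within n) A ×
  (∀ (i j : Fin (length A)) → i ≢ j → Disjoint (lookup A i) (lookup A j))

FixedPacking : Polyomino → List Polyomino → Set
FixedPacking P A =
  ValidArrangement (size P) A ×
  All (λ Q → FixedEquiv Q P) A ×
  (∀ (Q : Polyomino) → FixedEquiv Q P → ¬ ValidArrangement (size P) (Q ∷ A))

CpFixedIs : Polyomino → ℕ → Set
CpFixedIs P k =
  (Σ[ A ∈ List Polyomino ] (FixedPacking P A × length A ≡ k)) ×
  (∀ (A : List Polyomino) → FixedPacking P A → k ≤ length A)

-- L_{a,a} = {C_{i,1} : 1 ≤ i ≤ a+1} ∪ {C_{1,j} : 1 < j ≤ a+1}   (duplicate-free, size 2a+1)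
L : ℕ → Polyomino
L a = map (λ i → (+ suc i , + 1)) (upTo (suc a))
   ++ map (λ k → (+ 1 , + suc (suc k))) (upTo a)

{-# OPTIONS --safe #-}
-- Push L_{a,a} all the way right: its vertical bar then fills column a+1 from row 1
-- to row a+1. Any shift of L_{a,a} inside the board is by some (c, d) with
-- 0 ≤ c, d ≤ a, so its horizontal bar, lying in row d+1 and spanning columns c+1
-- to c+a+1, crosses column a+1 and hits that vertical bar. Hence this single copy is
-- already a packing, and no packing is empty because that copy could be added to it.
module Submission where

open import Defs
open import Data.Nat using (ℕ; suc; _≤_; _+_; z≤n; s≤s; s≤s⁻¹)
open import Data.Nat.Properties using (≤-refl; ≤-trans; +-identityʳ; +-mono-≤; +-cancelˡ-≤; m≤m+n; m∸n≤m; m∸n+n≡m)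
open import Data.Integer using (+_; -[1+_]; +≤+) renaming (_+_ to _+ℤ_; _≤_ to _≤ℤ_)
open import Data.Product using (_×_; _,_; proj₁; proj₂; ∃-syntax)
open import Data.Sum using (_⊎_; inj₁; inj₂)
open import Data.List using ([]; _∷_; map; upTo)
open import Data.List.Properties using (length-++; length-map; length-upTo)
open import Data.List.Membership.Propositional using (_∈_)
open import Data.List.Membership.Propositional.Properties using (∈-++⁺ˡ; ∈-++⁺ʳ; ∈-++⁻; ∈-map⁺; ∈-map⁻; ∈-upTo⁺; ∈-upTo⁻)
open import Data.List.Relation.Unary.All using ([]; _∷_)
open import Data.Fin using () renaming (zero to fzero; suc to fsuc)
open import Relation.Binary.PropositionalEquality using (_≡_; refl; sym; trans; cong₂; subst)
open import Relation.Nullary using (¬_)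
open import Data.Empty using (⊥-elim)
open import Function.Base using (_∘_)
open import Function.Bundles using (Equivalence)
open import Function.Properties.Equivalence using () renaming (refl to ⇔-refl)

∈-shift⁺ : ∀ {P x y} c d → (x , y) ∈ P → (x +ℤ c , y +ℤ d) ∈ shift P c d
∈-shift⁺ c d = ∈-map⁺ (λ { (x , y) → (x +ℤ c , y +ℤ d) })

singleton-valid : ∀ {n Q} → Within n Q → ValidArrangement n (Q ∷ [])
singleton-valid Q⊆B = (Q⊆B ∷ []) , λ { fzero fzero 0≢0 → ⊥-elim (0≢0 refl) }

singleton-fixedPacking : ∀ {P Q} → Within (size P) Q → FixedEquiv Q P →
  (∀ c d → Within (size P) (shift P c d) → ¬ Disjoint (shift P c d) Q) →
  FixedPacking P (Q ∷ [])
singleton-fixedPacking Q⊆B Q≈P meets =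
  singleton-valid Q⊆B , (Q≈P ∷ []) ,
  λ { R (c , d , R≈P) ((R⊆B ∷ _) , disjoint) →
        meets c d (λ x x∈P′ → R⊆B x (from R≈P x x∈P′))
                  (λ x x∈P′ → disjoint fzero (fsuc fzero) (λ ()) x (from R≈P x x∈P′)) }
  where
  from : ∀ {R S} → SameCells R S → ∀ x → x ∈ S → x ∈ R
  from R≈S x = Equivalence.from (R≈S x)

singleton-fixedPacking⇒cpFixed≡1 : ∀ {P Q} → FixedPacking P (Q ∷ []) → CpFixedIs P 1
singleton-fixedPacking⇒cpFixed≡1 {Q = Q} packing@(((Q⊆B ∷ []) , _) , (Q≈P ∷ []) , _) =
  ((Q ∷ []) , packing , refl) ,
  λ { [] (_ , _ , maximal) → ⊥-elim (maximal Q Q≈P (singleton-valid Q⊆B))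
    ; (_ ∷ _) _ → s≤s z≤n }

size-L : ∀ a → size (L a) ≡ suc a + a
size-L a = trans (length-++ (map (λ i → (+ suc i , + 1)) (upTo (suc a))))
  (cong₂ _+_ (trans (length-map _ (upTo (suc a))) (length-upTo (suc a)))
             (trans (length-map _ (upTo a)) (length-upTo a)))

L-row : ∀ a {i} → i ≤ a → (+ suc i , + 1) ∈ L a
L-row a i≤a = ∈-++⁺ˡ (∈-map⁺ (λ i → (+ suc i , + 1)) (∈-upTo⁺ (s≤s i≤a)))

L-column : ∀ a {j} → j ≤ a → (+ 1 , + suc j) ∈ L a
L-column a {0} _ = L-row a z≤n
L-column a {suc k} k<a = ∈-++⁺ʳ (map (λ i → (+ suc i , + 1)) (upTo (suc a)))
  (∈-map⁺ (λ k → (+ 1 , + suc (suc k))) (∈-upTo⁺ k<a))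

L-cells : ∀ a {x} → x ∈ L a →
  (∃[ i ] (i ≤ a × x ≡ (+ suc i , + 1))) ⊎ (∃[ j ] (j ≤ a × x ≡ (+ 1 , + suc j)))
L-cells a x∈L with ∈-++⁻ (map (λ i → (+ suc i , + 1)) (upTo (suc a))) x∈L
... | inj₁ x∈row with ∈-map⁻ (λ i → (+ suc i , + 1)) x∈row
...   | i , i∈ , refl = inj₁ (i , s≤s⁻¹ (∈-upTo⁻ i∈) , refl)
L-cells a x∈L | inj₂ x∈column with ∈-map⁻ (λ k → (+ 1 , + suc (suc k))) x∈column
...   | k , k∈ , refl = inj₂ (suc k , ∈-upTo⁻ k∈ , refl)

shift-L-within : ∀ a {c d} → c ≤ a → d ≤ a → Within (suc a + a) (shift (L a) (+ c) (+ d))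
shift-L-within a {c} {d} c≤a d≤a x x∈ with ∈-map⁻ (λ { (x , y) → (x +ℤ + c , y +ℤ + d) }) x∈
... | y , y∈L , refl with L-cells a y∈L
...   | inj₁ (i , i≤a , refl) =
        +≤+ (s≤s z≤n) , +≤+ (+-mono-≤ (s≤s i≤a) c≤a) , +≤+ (s≤s z≤n) , +≤+ (s≤s (≤-trans d≤a (m≤m+n a a)))
...   | inj₂ (j , j≤a , refl) =
        +≤+ (s≤s z≤n) , +≤+ (s≤s (≤-trans c≤a (m≤m+n a a))) , +≤+ (s≤s z≤n) , +≤+ (+-mono-≤ (s≤s j≤a) d≤a)

1+negative≱1 : ∀ k → ¬ (+ 1 ≤ℤ + 1 +ℤ -[1+ k ])
1+negative≱1 0 (+≤+ ())
1+negative≱1 (suc k) ()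

rightL : ℕ → Polyomino
rightL a = shift (L a) (+ a) (+ 0)

shift-L-meets-rightL : ∀ a c d → Within (suc a + a) (shift (L a) c d) → ¬ Disjoint (shift (L a) c d) (rightL a)
shift-L-meets-rightL a -[1+ k ] d within _ =
  1+negative≱1 k (proj₁ (within _ (∈-shift⁺ _ d (L-row a z≤n))))
shift-L-meets-rightL a (+ c) -[1+ k ] within _ =
  1+negative≱1 k (proj₁ (proj₂ (proj₂ (within _ (∈-shift⁺ (+ c) _ (L-row a z≤n))))))
shift-L-meets-rightL a (+ c) (+ d) within disjoint = disjoint (+ suc a , + suc d) in-shift in-rightL
  where
  c≤a : c ≤ a
  c≤a with proj₁ (proj₂ (within _ (∈-shift⁺ (+ c) (+ d) (L-row a ≤-refl))))
  ... | +≤+ a+c≤a+a = +-cancelˡ-≤ (suc a) c a a+c≤a+a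
  d≤a : d ≤ a
  d≤a with proj₂ (proj₂ (proj₂ (within _ (∈-shift⁺ (+ c) (+ d) (L-column a ≤-refl)))))
  ... | +≤+ a+d≤a+a = +-cancelˡ-≤ (suc a) d a a+d≤a+a
  in-shift : (+ suc a , + suc d) ∈ shift (L a) (+ c) (+ d)
  in-shift = subst (λ z → (+ suc z , + suc d) ∈ shift (L a) (+ c) (+ d)) (m∸n+n≡m c≤a)
                   (∈-shift⁺ (+ c) (+ d) (L-row a (m∸n≤m a c)))
  in-rightL : (+ suc a , + suc d) ∈ rightL a
  in-rightL = subst (λ z → (+ suc a , + z) ∈ rightL a) (+-identityʳ (suc d))
                    (∈-shift⁺ (+ a) (+ 0) (L-column a d≤a))

rightL-fixedPacking : ∀ a → FixedPacking (L a) (rightL a ∷ [])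
rightL-fixedPacking a =
  singleton-fixedPacking {L a} {rightL a} (onBoard (shift-L-within a ≤-refl z≤n)) (+ a , + 0 , λ _ → ⇔-refl)
    (λ c d → shift-L-meets-rightL a c d ∘ subst (λ n → Within n (shift (L a) c d)) (size-L a))
  where
  onBoard : ∀ {Q} → Within (suc a + a) Q → Within (size (L a)) Q
  onBoard {Q} = subst (λ n → Within n Q) (sym (size-L a))

theorem3p8 : (a : ℕ) → 1 ≤ a → CpFixedIs (L a) 1
theorem3p8 a _ = singleton-fixedPacking⇒cpFixed≡1 {L a} {rightL a} (rightL-fixedPacking a)
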